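{- For every formula $A$, $A$ is derivable in $\mathsf V_\preccurlyeq$ if and only if $A$ is derivable in $\mathsf N_\preccurlyeq\cup\{\mathrm{co}\}$.
   Context: Language: formulas $A ::= p \mid \bot \mid A\to A \mid A \preccurlyeq A$ over countably many atoms; $\top,\neg,\wedge,\vee$ defined as usual. Axioms and rules: (cpr) from $A\to B$ infer $B\preccurlyeq A$; (tr) $(A\preccurlyeq B)\wedge(B\preccurlyeq C)\to(A\preccurlyeq C)$; (or) $(A\preccurlyeq B)\wedge(A\preccurlyeq C)\to(A\preccurlyeq B\vee C)$; (co) $(A\preccurlyeq B)\vee(B\preccurlyeq A)$; (cpa) $(A\preccurlyeq A\vee B)\vee(B\preccurlyeq A\vee B)$. $\mathsf N_\preccurlyeq$ is classical propositional logic (in this language) plus tr, or, cpr; $\mathsf N_\preccurlyeq\cup\{\mathrm{co}\}$ additionally has co. $\mathsf V_\preccurlyeq$ (Lewis' logic) is classical propositional logic plus cpr, cpa, tr, co. A formula is derivable in a system if there is a finite sequence ending in it whose elements are axioms or obtained from earlier ones by modus ponens or cpr. -}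

module Defs where

open import Data.Nat using (ℕ)
open import Function.Bundles using (_⇔_)

infixr 6 _⇒_
infix 7 _≼_

data Formula : Set where
  atom : ℕ → Formula
  ⊥'   : Formula
  _⇒_  : Formula → Formula → Formula
  _≼_  : Formula → Formula → Formula

¬' : Formula → Formula
¬' A = A ⇒ ⊥'

⊤' : Formula
⊤' = ⊥' ⇒ ⊥'

infixr 5 _∨'_
infixr 5 _∧'_

_∨'_ : Formula → Formula → Formula
A ∨' B = ¬' A ⇒ B

_∧'_ : Formula → Formula → Formula
A ∧' B = ¬' (A ⇒ ¬' B)

-- Axioms of classical propositional logic (a standard complete Hilbert system
-- for the language with ⊥ and →; the modal subformulas are treated as atoms).
data CPL-axiom : Formula → Set where
  ax-K  : ∀ A B → CPL-axiom (A ⇒ B ⇒ A)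
  ax-S  : ∀ A B C → CPL-axiom ((A ⇒ B ⇒ C) ⇒ (A ⇒ B) ⇒ A ⇒ C)
  ax-DN : ∀ A → CPL-axiom (¬' (¬' A) ⇒ A)

data ⊢N+co : Formula → Set where
  cpl : ∀ {A} → CPL-axiom A → ⊢N+co A
  tr  : ∀ A B C → ⊢N+co (((A ≼ B) ∧' (B ≼ C)) ⇒ (A ≼ C))
  or  : ∀ A B C → ⊢N+co (((A ≼ B) ∧' (A ≼ C)) ⇒ (A ≼ (B ∨' C)))
  co  : ∀ A B → ⊢N+co ((A ≼ B) ∨' (B ≼ A))
  mp  : ∀ {A B} → ⊢N+co (A ⇒ B) → ⊢N+co A → ⊢N+co B
  cpr : ∀ {A B} → ⊢N+co (A ⇒ B) → ⊢N+co (B ≼ A)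

data ⊢V : Formula → Set where
  cpl : ∀ {A} → CPL-axiom A → ⊢V A
  cpa : ∀ A B → ⊢V ((A ≼ (A ∨' B)) ∨' (B ≼ (A ∨' B)))
  tr  : ∀ A B C → ⊢V (((A ≼ B) ∧' (B ≼ C)) ⇒ (A ≼ C))
  co  : ∀ A B → ⊢V ((A ≼ B) ∨' (B ≼ A))
  mp  : ∀ {A B} → ⊢V (A ⇒ B) → ⊢V A → ⊢V B
  cpr : ∀ {A B} → ⊢V (A ⇒ B) → ⊢V (B ≼ A)

{-# OPTIONS --safe #-}
module Submission where

-- Each system derives the axiom the other has in place of its own, and the
-- rules are shared, so the two translations are identities on all other
-- constructors. In V≼, (or) follows from cpa for B, C by a case split, each
-- case closed by tr through B ≼ B ∨ C or C ≼ B ∨ C. In N≼ ∪ {co}, cpa follows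
-- from co for A, B: if B ≼ A then or with A ≼ A gives A ≼ A ∨ B, and
-- symmetrically, using that B ∨ A ≼ A ∨ B holds by cpr.

open import Data.List using (List; []; _∷_)
open import Data.List.Membership.Propositional using (_∈_)
open import Data.List.Relation.Unary.Any using (here; there)
open import Function.Bundles using (_⇔_; mk⇔)
open import Relation.Binary.PropositionalEquality using (refl)

open import Defs

module HilbertReasoning (⊢_ : Formula → Set)
                        (axiom : ∀ {A} → CPL-axiom A → ⊢ A)
                        (modus-ponens : ∀ {A B} → ⊢ (A ⇒ B) → ⊢ A → ⊢ B) where

  infix 4 _⊩_

  data _⊩_ (Γ : List Formula) : Formula → Set where
    hyp : ∀ {A} → A ∈ Γ → Γ ⊩ A
    thm : ∀ {A} → ⊢ A → Γ ⊩ A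
    app : ∀ {A B} → Γ ⊩ (A ⇒ B) → Γ ⊩ A → Γ ⊩ B

  var₀ : ∀ {Γ A} → A ∷ Γ ⊩ A
  var₀ = hyp (here refl)

  var₁ : ∀ {Γ A B} → B ∷ A ∷ Γ ⊩ A
  var₁ = hyp (there (here refl))

  ⊢-refl : ∀ A → ⊢ (A ⇒ A)
  ⊢-refl A = modus-ponens (modus-ponens (axiom (ax-S A (A ⇒ A) A)) (axiom (ax-K A (A ⇒ A))))
                          (axiom (ax-K A A))

  weaken : ∀ {Γ A B} → Γ ⊩ A → B ∷ Γ ⊩ A
  weaken (hyp p)   = hyp (there p)
  weaken (thm t)   = thm t
  weaken (app d e) = app (weaken d) (weaken e)

  deduction : ∀ {Γ A B} → A ∷ Γ ⊩ B → Γ ⊩ (A ⇒ B)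
  deduction {A = A} (hyp (here refl)) = thm (⊢-refl A)
  deduction (hyp (there p)) = app (thm (axiom (ax-K _ _))) (hyp p)
  deduction (thm t)         = app (thm (axiom (ax-K _ _))) (thm t)
  deduction (app d e)       = app (app (thm (axiom (ax-S _ _ _))) (deduction d)) (deduction e)

  closed : ∀ {A} → [] ⊩ A → ⊢ A
  closed (thm t)   = t
  closed (app d e) = modus-ponens (closed d) (closed e)

  ¬¬-elim : ∀ {Γ} A → Γ ⊩ ¬' (¬' A) → Γ ⊩ A
  ¬¬-elim A d = app (thm (axiom (ax-DN A))) d

  ⊥-elim : ∀ {Γ} A → Γ ⊩ ⊥' → Γ ⊩ A
  ⊥-elim A d = ¬¬-elim A (deduction (weaken d))

  ∨-elim : ∀ {Γ A B} C → Γ ⊩ (A ∨' B) → Γ ⊩ (A ⇒ C) → Γ ⊩ (B ⇒ C) → Γ ⊩ C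
  ∨-elim C d f g = ¬¬-elim C (deduction (app var₀ (app (weaken g) (app (weaken d)
      (deduction (app var₁ (app (weaken (weaken f)) var₀)))))))

  ∨-introˡ : ∀ {Γ A} B → Γ ⊩ A → Γ ⊩ (A ∨' B)
  ∨-introˡ B a = deduction (⊥-elim B (app var₀ (weaken a)))

  ∨-introʳ : ∀ {Γ B} A → Γ ⊩ B → Γ ⊩ (A ∨' B)
  ∨-introʳ A b = deduction (weaken b)

  ∧-intro : ∀ {Γ A B} → Γ ⊩ A → Γ ⊩ B → Γ ⊩ (A ∧' B)
  ∧-intro a b = deduction (app (app var₀ (weaken a)) (weaken b))

  ∧-elimˡ : ∀ {Γ} A B → Γ ⊩ (A ∧' B) → Γ ⊩ A
  ∧-elimˡ A B c = ¬¬-elim A (deduction (app (weaken c) (deduction (⊥-elim (¬' B) (app var₁ var₀)))))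

  ∧-elimʳ : ∀ {Γ} A B → Γ ⊩ (A ∧' B) → Γ ⊩ B
  ∧-elimʳ A B c = ¬¬-elim B (deduction (app (weaken c) (deduction var₁)))

  ∨-comm : ∀ A B → ⊢ ((A ∨' B) ⇒ (B ∨' A))
  ∨-comm A B = closed (deduction (deduction (¬¬-elim A (deduction
    (app var₁ (app (hyp (there (there (here refl)))) var₀))))))

or-in-V : ∀ A B C → ⊢V (((A ≼ B) ∧' (A ≼ C)) ⇒ (A ≼ (B ∨' C)))
or-in-V A B C = closed (deduction (∨-elim (A ≼ (B ∨' C)) (thm (cpa B C))
    (deduction (app (thm (tr A B (B ∨' C))) (∧-intro (weaken (∧-elimˡ (A ≼ B) (A ≼ C) var₀)) var₀)))
    (deduction (app (thm (tr A C (B ∨' C))) (∧-intro (weaken (∧-elimʳ (A ≼ B) (A ≼ C) var₀)) var₀)))))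
  where open HilbertReasoning ⊢V cpl mp

cpa-in-N+co : ∀ A B → ⊢N+co ((A ≼ (A ∨' B)) ∨' (B ≼ (A ∨' B)))
cpa-in-N+co A B = closed (∨-elim ((A ≼ (A ∨' B)) ∨' (B ≼ (A ∨' B))) (thm (co A B))
    (deduction (∨-introˡ (B ≼ (A ∨' B)) (≼-join A B var₀)))
    (deduction (∨-introʳ (A ≼ (A ∨' B))
      (app (thm (tr B (B ∨' A) (A ∨' B))) (∧-intro (≼-join B A var₀) (thm (cpr (∨-comm A B))))))))
  where
  open HilbertReasoning ⊢N+co cpl mp

  ≼-join : ∀ {Γ} X Y → Γ ⊩ (X ≼ Y) → Γ ⊩ (X ≼ (X ∨' Y))
  ≼-join X Y d = app (thm (or X X Y)) (∧-intro (thm (cpr (⊢-refl X))) d)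

V⇒N+co : ∀ {A} → ⊢V A → ⊢N+co A
V⇒N+co (cpl x)     = cpl x
V⇒N+co (cpa A B)   = cpa-in-N+co A B
V⇒N+co (tr A B C)  = tr A B C
V⇒N+co (co A B)    = co A B
V⇒N+co (mp d e)    = mp (V⇒N+co d) (V⇒N+co e)
V⇒N+co (cpr d)     = cpr (V⇒N+co d)

N+co⇒V : ∀ {A} → ⊢N+co A → ⊢V A
N+co⇒V (cpl x)     = cpl x
N+co⇒V (tr A B C)  = tr A B C
N+co⇒V (or A B C)  = or-in-V A B C
N+co⇒V (co A B)    = co A B
N+co⇒V (mp d e)    = mp (N+co⇒V d) (N+co⇒V e)
N+co⇒V (cpr d)     = cpr (N+co⇒V d)

proposition3p10 : (A : Formula) → ⊢V A ⇔ ⊢N+co A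
proposition3p10 A = mk⇔ V⇒N+co N+co⇒V
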